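{- Let $(A_h)_{h\ge0}$ and $(B_h)_{h\ge0}$ be formal power series in $x$ with coefficients in $\mathbb{Q}(q)$ satisfying \[ A_0=1+a_0B_1,\quad B_0=1+b_0A_1,\qquad A_h=A_{h-1}+a_hB_{h+1},\quad B_h=B_{h-1}+b_hA_{h+1}\quad(h\ge1). \] Then \[ \begin{pmatrix}A_0\\ B_0\end{pmatrix}=\mathbf{S}_0^{ -1}\begin{pmatrix}1\\1\end{pmatrix}, \] i.e. $A_0=(1\ 0)\,\mathbf{S}_0^{ -1}(1,1)^T$ and $B_0=(0\ 1)\,\mathbf{S}_0^{ -1}(1,1)^T$.
   Context: For $h\geq 0$ set $a_h=xq^{\lceil (h+1)/2\rceil}$, $b_h=xq^{\lfloor (h+1)/2\rfloor}$, $\mathbf{U}_h=\begin{pmatrix}0&a_h\\ b_h&0\end{pmatrix}$, and let $\mathbf{I}$ be the $2\times 2$ identity. The matrix $\mathbf{S}_0$ is the infinite matrix continued fraction $\mathbf{S}_0=\mathbf{I}-\mathbf{U}_0\bigl(\mathbf{I}-\mathbf{U}_1(\mathbf{I}-\mathbf{U}_2(\cdots)^{ -1})^{ -1}\bigr)^{ -1}$, defined as follows: for $N\ge0$ put $\mathbf{S}^{(N)}_{N+1}=\mathbf{I}$ and $\mathbf{S}^{(N)}_h=\mathbf{I}-\mathbf{U}_h(\mathbf{S}^{(N)}_{h+1})^{ -1}$ for $h=N,\dots,0$; these matrices over $\mathbb{Q}(q)[[x]]$ are invertible, the entries of $\mathbf{S}_0^{(N)}$ stabilize coefficientwise in $x$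 as $N\to\infty$, and $\mathbf{S}_0$ is the coefficientwise limit (so $\mathbf{S}_0\equiv\mathbf{I}\pmod x$ and is invertible). In the paper, $A_h,B_h$ are the generating functions read off from an automaton on partial Dyck paths tracking length (by $x$) and black cell capacity (by $q$), characterized by the displayed recurrences. -}

module Defs where

open import Data.Nat as ℕ using (ℕ; zero; suc; _≤_)
open import Data.Nat.DivMod using (_/_)
open import Data.Rational as Q using (ℚ; 0ℚ; 1ℚ)
open import Data.List using (List; []; _∷_; foldr; map; reverse; zipWith)
open import Data.List.Relation.Unary.Any using (Any; any?)
open import Data.Product using (Σ; _,_; proj₁; ∃-syntax; _×_)
open import Relation.Binary.PropositionalEquality using (_≡_; _≢_)
open import Relation.Nullary using (yes; no; ¬_)

-- Polynomials in q over ℚ (coefficient lists, lowest degree first)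

Poly : Set
Poly = List ℚ

coeffP : Poly → ℕ → ℚ
coeffP []       _       = 0ℚ
coeffP (c ∷ p)  zero    = c
coeffP (c ∷ p)  (suc n) = coeffP p n

-- equality of polynomials (up to trailing zeros)
_≈P_ : Poly → Poly → Set
p ≈P r = ∀ n → coeffP p n ≡ coeffP r n

addP : Poly → Poly → Poly
addP []      r       = r
addP p       []      = p
addP (a ∷ p) (b ∷ r) = (a Q.+ b) ∷ addP p r

scaleP : ℚ → Poly → Poly
scaleP c = map (c Q.*_)

mulP : Poly → Poly → Poly
mulP []      r = []
mulP (a ∷ p) r = addP (scaleP a r) (0ℚ ∷ mulP p r)

NZPoly : Set
NZPoly = Σ Poly (Any (λ c → c ≢ 0ℚ))

prodNZ : List NZPoly → Poly
prodNZ = foldr (λ d acc → mulP (proj₁ d) acc) (1ℚ ∷ [])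

-- The field ℚ(q) of rational functions: numerator / (product of nonzero
-- polynomials), with the usual cross-multiplication equality.

record Rat : Set where
  constructor frac
  field
    num  : Poly
    dens : List NZPoly

den : Rat → Poly
den r = prodNZ (Rat.dens r)

_≈R_ : Rat → Rat → Set
r ≈R s = mulP (Rat.num r) (den s) ≈P mulP (Rat.num s) (den r)

0R 1R qR : Rat
0R = frac [] []
1R = frac (1ℚ ∷ []) []
qR = frac (0ℚ ∷ 1ℚ ∷ []) []

_+R_ _*R_ : Rat → Rat → Rat
frac n₁ d₁ +R frac n₂ d₂ =
  frac (addP (mulP n₁ (prodNZ d₂)) (mulP n₂ (prodNZ d₁))) (d₁ Data.List.++ d₂)
frac n₁ d₁ *R frac n₂ d₂ = frac (mulP n₁ n₂) (d₁ Data.List.++ d₂)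

-R_ : Rat → Rat
-R frac n d = frac (scaleP (Q.- 1ℚ) n) d

-- multiplicative inverse (inverse of 0 is set to 0)
invR : Rat → Rat
invR (frac n d) with any? (λ c → Relation.Nullary.¬? (c Q.≟ 0ℚ)) n
... | yes nz = frac (prodNZ d) ((n , nz) ∷ [])
... | no  _  = 0R

qpow : ℕ → Rat
qpow zero    = 1R
qpow (suc k) = qR *R qpow k

PS : Set
PS = ℕ → Rat

_≈S_ : PS → PS → Set
f ≈S g = ∀ n → f n ≈R g n

constS : Rat → PS
constS c zero    = c
constS c (suc n) = 0R

0S 1S : PS
0S = constS 0R
1S = constS 1R

xTimes : Rat → PS
xTimes c zero          = 0R
xTimes c (suc zero)    = c
xTimes c (suc (suc n)) = 0R

_+S_ : PS → PS → PS
(f +S g) n = f n +R g n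

-S_ : PS → PS
(-S f) n = -R f n

_-S_ : PS → PS → PS
f -S g = f +S (-S g)

sumR : List Rat → Rat
sumR = foldr _+R_ 0R

sumTo : ℕ → (ℕ → Rat) → Rat
sumTo zero    f = f zero
sumTo (suc n) f = sumTo n f +R f (suc n)

_*S_ : PS → PS → PS
(f *S g) n = sumTo n (λ k → f k *R g (n ℕ.∸ k))

-- multiplicative inverse of a power series with invertible constant term:
-- g₀ = f₀⁻¹,  gₙ = - f₀⁻¹ Σ_{k=1}^{n} f_k g_{n-k}.
-- invList f n = [gₙ, …, g₀]
invList : PS → ℕ → List Rat
invList f zero    = invR (f 0) ∷ []
invList f (suc n) =
  let rev = invList f n
      fs  = Data.List.map (λ i → f (suc i)) (Data.List.upTo (suc n))
  in (-R (invR (f 0) *R sumR (zipWith _*R_ fs rev))) ∷ rev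

headR : List Rat → Rat
headR []      = 0R
headR (c ∷ _) = c

invS : PS → PS
invS f n = headR (invList f n)

record M2 : Set where
  constructor mat
  field
    m11 m12 m21 m22 : PS
open M2 public

I2 : M2
I2 = mat 1S 0S 0S 1S

_*M_ : M2 → M2 → M2
mat a b c d *M mat e f g h =
  mat ((a *S e) +S (b *S g)) ((a *S f) +S (b *S h))
      ((c *S e) +S (d *S g)) ((c *S f) +S (d *S h))

_-M_ : M2 → M2 → M2
mat a b c d -M mat e f g h = mat (a -S e) (b -S f) (c -S g) (d -S h)

det : M2 → PS
det (mat a b c d) = (a *S d) -S (b *S c)

invM : M2 → M2
invM M@(mat a b c d) =
  let i = invS (det M) in
  mat (i *S d) (i *S (-S b)) (i *S (-S c)) (i *S a)

-- a_h = x q^{⌈(h+1)/2⌉},  b_h = x q^{⌊(h+1)/2⌋}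
aS bS : ℕ → PS
aS h = xTimes (qpow ((h ℕ.+ 2) / 2))
bS h = xTimes (qpow ((h ℕ.+ 1) / 2))

U : ℕ → M2
U h = mat 0S (aS h) (bS h) 0S

-- Sk k h = S^{(N)}_h  where  k = N + 1 - h  (so Sk 0 h = I = S^{(N)}_{N+1})
Sk : ℕ → ℕ → M2
Sk zero    h = I2
Sk (suc k) h = I2 -M (U h *M invM (Sk k (suc h)))

SN0 : ℕ → M2
SN0 N = Sk (suc N) 0

_≈M_ : M2 → M2 → Set
M ≈M M' = (m11 M ≈S m11 M') × (m12 M ≈S m12 M')
        × (m21 M ≈S m21 M') × (m22 M ≈S m22 M')

IsS0 : M2 → Set
IsS0 S = ∀ n → ∃[ N₀ ] ∀ N → N₀ ≤ N →
  (SN0 N .m11 n ≈R S .m11 n) × (SN0 N .m12 n ≈R S .m12 n)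
  × (SN0 N .m21 n ≈R S .m21 n) × (SN0 N .m22 n ≈R S .m22 n)

-- first and second component of  M · (1,1)ᵀ
row1·11 row2·11 : M2 → PS
row1·11 M = m11 M +S m12 M
row2·11 M = m21 M +S m22 M

-- Put W₀ = (1, 1) and W_{h+1} = (A_h, B_h); the recurrences say exactly
-- W_{h+1} = W_h + U_h W_{h+2}.  Let T_{k,h} = Sk k h be the continued fraction with
-- k levels started at h, so T_{0,h} = I, T_{k+1,h} = I − U_h T_{k,h+1}⁻¹ and
-- S^{(N)}_0 = T_{N+1,0}.  By induction on k, W_h ≡ T_{k,h} W_{h+1} modulo x^{k+1}:
-- the error at k+1 levels is U_h T_{k,h+1}⁻¹ (W_{h+1} − T_{k,h+1} W_{h+2}), and U_h is
-- divisible by x.  Since S₀ agrees with S^{(N)}_0 modulo x^{n+1} for large N,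
-- (1, 1) ≡ S₀ W₁ modulo every power of x, hence W₁ = S₀⁻¹ (1, 1).  Every matrix
-- inverted here has constant term I (U_h has none), so its determinant is invertible.

module Submission where

open import Defs
open import Data.Nat using (ℕ; suc; zero)
open import Data.Product using (_×_)

open import Algebra
open import Algebra.Morphism.Structures using (IsRingMonomorphism)
import Algebra.Morphism.RingMonomorphism as RingMonomorphism
open import Algebra.Structures using (IsCommutativeRing)
open import Data.Bool using (Bool; true; false; T)
open import Data.Empty using (⊥-elim)
open import Data.Integer as ℤ using (ℤ; +_; -[1+_]; _⊖_; _◃_)
import Data.Integer.Properties as ℤ
open import Data.List using (List; []; _∷_; _++_; map; zipWith; upTo; applyUpTo; downFrom)
open import Data.List.Properties using (map-upTo)
open import Data.List.Relation.Unary.Any using (Any; here; there; any?)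
open import Data.Maybe using (nothing)
open import Data.Nat as ℕ using (_∸_; _<_; _≤_; z≤n; s≤s; _⊔_)
import Data.Nat.Properties as ℕ
open import Data.Product using (Σ; _,_; proj₁; proj₂; ∃-syntax)
open import Data.Rational as ℚ using (ℚ; 0ℚ; 1ℚ)
import Data.Rational.Properties as ℚ
open import Data.Sign as Sign using (Sign)
open import Data.Sum using (inj₁; inj₂)
open import Data.Vec using (Vec)
open import Relation.Binary.Bundles using (Setoid)
open import Relation.Binary.PropositionalEquality as ≡ using (_≡_; _≢_; cong; cong₂)
open import Relation.Nullary using (¬_; yes; no; ¬?)

-- Tactic.RingSolver takes its coefficients from the ring itself, so in a ring without
-- decidable equality (such as ℚ(q)[[x]]) it cannot see that 1# - 1# is 0#.  With
-- integer coefficients, normal forms are compared by evaluation.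
module IntegerCoefficientSolver {c ℓ} (R : CommutativeRing c ℓ) where

  open import Tactic.RingSolver.Core.AlmostCommutativeRing
  open import Tactic.RingSolver.Core.Polynomial.Parameters
  open import Tactic.RingSolver.Core.Expression public

  almostCommutativeRing : AlmostCommutativeRing c ℓ
  almostCommutativeRing = fromCommutativeRing R (λ _ → nothing)

  open CommutativeRing R
  open import Relation.Binary.Reasoning.Setoid setoid
  open import Algebra.Properties.Semiring.Mult.TCOptimised semiring
    using (1+×; ×-homo-+; ×1-homo-*) renaming (_×_ to _×′_)
  open import Algebra.Properties.Ring ring
    using (-‿distribˡ-*; -‿distribʳ-*; -0#≈0#; -‿involutive)
  open import Algebra.Properties.AbelianGroup +-abelianGroup
    using (⁻¹-∙-comm)
  open import Algebra.Properties.CommutativeSemigroup +-commutativeSemigroup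
    using () renaming (interchange to +-interchange)

  -- The optimised multiple has 1 ×′ x = x definitionally, which gives 1-homo = refl.
  ⟦_⟧ℤ : ℤ → Carrier
  ⟦ + n ⟧ℤ      = n ×′ 1#
  ⟦ -[1+ n ] ⟧ℤ = - (suc n ×′ 1#)

  ⟦⟧ℤ-homo-⊖ : ∀ m n → ⟦ m ⊖ n ⟧ℤ ≈ m ×′ 1# - n ×′ 1#
  ⟦⟧ℤ-homo-⊖ m zero = begin
    ⟦ m ⊖ 0 ⟧ℤ      ≡⟨ ≡.cong ⟦_⟧ℤ (ℤ.⊖-≥ {m} ℕ.z≤n) ⟩
    m ×′ 1#         ≈⟨ +-identityʳ _ ⟨
    m ×′ 1# + 0#    ≈⟨ +-congˡ -0#≈0# ⟨
    m ×′ 1# - 0#    ∎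
  ⟦⟧ℤ-homo-⊖ zero (suc n) = sym (+-identityˡ _)
  ⟦⟧ℤ-homo-⊖ (suc m) (suc n) = begin
    ⟦ suc m ⊖ suc n ⟧ℤ                ≡⟨ ≡.cong ⟦_⟧ℤ (ℤ.[1+m]⊖[1+n]≡m⊖n m n) ⟩
    ⟦ m ⊖ n ⟧ℤ                        ≈⟨ ⟦⟧ℤ-homo-⊖ m n ⟩
    m ×′ 1# - n ×′ 1#                 ≈⟨ cancel-1 (m ×′ 1#) (n ×′ 1#) ⟩
    (1# + m ×′ 1#) - (1# + n ×′ 1#)   ≈⟨ +-cong (1+× m 1#) (-‿cong (1+× n 1#)) ⟨
    suc m ×′ 1# - suc n ×′ 1#         ∎
    where
    cancel-1 : ∀ x y → x - y ≈ (1# + x) - (1# + y)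
    cancel-1 x y = begin
      x - y                    ≈⟨ +-identityˡ _ ⟨
      0# + (x - y)             ≈⟨ +-congʳ (-‿inverseʳ 1#) ⟨
      (1# - 1#) + (x - y)      ≈⟨ +-interchange 1# (- 1#) x (- y) ⟩
      (1# + x) + (- 1# - y)    ≈⟨ +-congˡ (⁻¹-∙-comm 1# y) ⟩
      (1# + x) - (1# + y)      ∎

  ⟦⟧ℤ-homo-+ : ∀ i j → ⟦ i ℤ.+ j ⟧ℤ ≈ ⟦ i ⟧ℤ + ⟦ j ⟧ℤ
  ⟦⟧ℤ-homo-+ (+ m)      (+ n)      = ×-homo-+ 1# m n
  ⟦⟧ℤ-homo-+ (+ m)      -[1+ n ]   = ⟦⟧ℤ-homo-⊖ m (suc n)
  ⟦⟧ℤ-homo-+ -[1+ m ]   (+ n)      = trans (⟦⟧ℤ-homo-⊖ n (suc m)) (+-comm _ _)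
  ⟦⟧ℤ-homo-+ -[1+ m ]   -[1+ n ]   = begin
    - (suc (suc (m ℕ.+ n)) ×′ 1#)     ≡⟨ ≡.cong (λ k → - (suc k ×′ 1#)) (ℕ.+-suc m n) ⟨
    - ((suc m ℕ.+ suc n) ×′ 1#)       ≈⟨ -‿cong (×-homo-+ 1# (suc m) (suc n)) ⟩
    - (suc m ×′ 1# + suc n ×′ 1#)     ≈⟨ ⁻¹-∙-comm _ _ ⟨
    - (suc m ×′ 1#) - (suc n ×′ 1#)   ∎

  signed : Sign → Carrier → Carrier
  signed Sign.+ x = x
  signed Sign.- x = - x

  ⟦⟧ℤ-◃ : ∀ s n → ⟦ s ◃ n ⟧ℤ ≈ signed s (n ×′ 1#)
  ⟦⟧ℤ-◃ Sign.+ zero    = refl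
  ⟦⟧ℤ-◃ Sign.+ (suc n) = refl
  ⟦⟧ℤ-◃ Sign.- zero    = sym -0#≈0#
  ⟦⟧ℤ-◃ Sign.- (suc n) = refl

  ⟦⟧ℤ-homo-* : ∀ i j → ⟦ i ℤ.* j ⟧ℤ ≈ ⟦ i ⟧ℤ * ⟦ j ⟧ℤ
  ⟦⟧ℤ-homo-* (+ m) (+ n) =
    trans (⟦⟧ℤ-◃ Sign.+ (m ℕ.* n)) (×1-homo-* m n)
  ⟦⟧ℤ-homo-* (+ m) -[1+ n ] =
    trans (⟦⟧ℤ-◃ Sign.- (m ℕ.* suc n)) (trans (-‿cong (×1-homo-* m (suc n))) (-‿distribʳ-* _ _))
  ⟦⟧ℤ-homo-* -[1+ m ] (+ n) =
    trans (⟦⟧ℤ-◃ Sign.- (suc m ℕ.* n)) (trans (-‿cong (×1-homo-* (suc m) n)) (-‿distribˡ-* _ _))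
  ⟦⟧ℤ-homo-* -[1+ m ] -[1+ n ] = begin
    ⟦ Sign.+ ◃ (suc m ℕ.* suc n) ⟧ℤ   ≈⟨ ⟦⟧ℤ-◃ Sign.+ (suc m ℕ.* suc n) ⟩
    (suc m ℕ.* suc n) ×′ 1#           ≈⟨ ×1-homo-* (suc m) (suc n) ⟩
    x * y                             ≈⟨ -‿involutive _ ⟨
    - - (x * y)                       ≈⟨ -‿cong (-‿distribˡ-* x y) ⟩
    - (- x * y)                       ≈⟨ -‿distribʳ-* (- x) y ⟩
    - x * - y                         ∎
    where
    x = suc m ×′ 1#
    y = suc n ×′ 1#

  ⟦⟧ℤ-homo-neg : ∀ i → ⟦ ℤ.- i ⟧ℤ ≈ - ⟦ i ⟧ℤ
  ⟦⟧ℤ-homo-neg (+ zero)  = sym -0#≈0#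
  ⟦⟧ℤ-homo-neg (+ suc n) = refl
  ⟦⟧ℤ-homo-neg -[1+ n ]  = sym (-‿involutive _)

  isZero : ℤ → Bool
  isZero (+ zero) = true
  isZero _        = false

  ⟦⟧ℤ-isZero : ∀ i → T (isZero i) → 0# ≈ ⟦ i ⟧ℤ
  ⟦⟧ℤ-isZero (+ zero) _ = refl

  homomorphism : Homomorphism _ _ c ℓ
  homomorphism = record
    { from = record { rawRing = ℤ.+-*-rawRing ; isZero = isZero }
    ; to = almostCommutativeRing
    ; morphism = record
      { ⟦_⟧ = ⟦_⟧ℤ ; +-homo = ⟦⟧ℤ-homo-+ ; *-homo = ⟦⟧ℤ-homo-* ; -‿homo = ⟦⟧ℤ-homo-neg
      ; 0-homo = refl ; 1-homo = refl }
    ; Zero-C⟶Zero-R = ⟦⟧ℤ-isZero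
    }

  open Eval rawRing ⟦_⟧ℤ public using (⟦_⟧)
  open import Tactic.RingSolver.Core.Polynomial.Base (Homomorphism.from homomorphism)
    using (κ; ι; _⊞_; _⊠_; ⊟_; _⊡_) renaming (Poly to Normal)
  open import Tactic.RingSolver.Core.Polynomial.Semantics homomorphism
    using () renaming (⟦_⟧ to ⟦_⟧ₙ)
  open import Tactic.RingSolver.Core.Polynomial.Homomorphism homomorphism
    using (κ-hom; ι-hom; ⊞-hom; ⊠-hom; ⊟-hom; ⊡-hom)
  open import Algebra.Properties.Semiring.Exp.TCOptimised semiring using (^-congˡ)

  normalise : ∀ {n} → Expr ℤ n → Normal n
  normalise (Κ x)   = κ x
  normalise (Ι x)   = ι x
  normalise (x ⊕ y) = normalise x ⊞ normalise y
  normalise (x ⊗ y) = normalise x ⊠ normalise y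
  normalise (⊝ x)   = ⊟ normalise x
  normalise (x ⊛ i) = normalise x ⊡ i

  ⟦_⇓⟧ : ∀ {n} → Expr ℤ n → Vec Carrier n → Carrier
  ⟦ e ⇓⟧ = ⟦ normalise e ⟧ₙ

  normalise-correct : ∀ {n} (e : Expr ℤ n) ρ → ⟦ e ⇓⟧ ρ ≈ ⟦ e ⟧ ρ
  normalise-correct (Κ x)   ρ = κ-hom x ρ
  normalise-correct (Ι x)   ρ = ι-hom x ρ
  normalise-correct (x ⊕ y) ρ =
    trans (⊞-hom (normalise x) (normalise y) ρ) (+-cong (normalise-correct x ρ) (normalise-correct y ρ))
  normalise-correct (x ⊗ y) ρ =
    trans (⊠-hom (normalise x) (normalise y) ρ) (*-cong (normalise-correct x ρ) (normalise-correct y ρ))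
  normalise-correct (⊝ x)   ρ = trans (⊟-hom (normalise x) ρ) (-‿cong (normalise-correct x ρ))
  normalise-correct (x ⊛ i) ρ = trans (⊡-hom (normalise x) i ρ) (^-congˡ i (normalise-correct x ρ))

  open import Relation.Binary.Reflection setoid Ι ⟦_⟧ ⟦_⇓⟧ normalise-correct public
    using (solve; _⊜_)

  0ₑ 1ₑ : ∀ {n} → Expr ℤ n
  0ₑ = Κ (+ 0)
  1ₑ = Κ (+ 1)

module CauchyProduct {c ℓ} (R : CommutativeRing c ℓ) where

  open CommutativeRing R
  open IntegerCoefficientSolver R using (solve; _⊜_; _⊕_; _⊗_)
  open import Relation.Binary.Reasoning.Setoid setoid

  Seq : Set c
  Seq = ℕ → Carrier

  infix 4 _≋_
  _≋_ : Seq → Seq → Set ℓ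
  f ≋ g = ∀ n → f n ≈ g n

  tail : Seq → Seq
  tail f n = f (suc n)

  infixl 6 _+ₛ_
  infixl 7 _⋆_
  _+ₛ_ : Seq → Seq → Seq
  (f +ₛ g) n = f n + g n

  -ₛ_ : Seq → Seq
  (-ₛ f) n = - f n

  0ₛ 1ₛ : Seq
  0ₛ _       = 0#
  1ₛ zero    = 1#
  1ₛ (suc _) = 0#

  _⋆_ : Seq → Seq → Seq
  (f ⋆ g) zero    = f 0 * g 0
  (f ⋆ g) (suc n) = f 0 * g (suc n) + (tail f ⋆ g) n

  Σ≤ : ℕ → (ℕ → Carrier) → Carrier
  Σ≤ zero    F = F 0
  Σ≤ (suc n) F = Σ≤ n F + F (suc n)

  Σ≤-unfoldˡ : ∀ n F → Σ≤ (suc n) F ≈ F 0 + Σ≤ n (λ k → F (suc k))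
  Σ≤-unfoldˡ zero    F = refl
  Σ≤-unfoldˡ (suc n) F = trans (+-congʳ (Σ≤-unfoldˡ n F)) (+-assoc _ _ _)

  Σ≤-⋆ : ∀ n f g → Σ≤ n (λ k → f k * g (n ∸ k)) ≈ (f ⋆ g) n
  Σ≤-⋆ zero    f g = refl
  Σ≤-⋆ (suc n) f g = trans (Σ≤-unfoldˡ n _) (+-congˡ (Σ≤-⋆ n (tail f) g))

  ⋆-cong : ∀ n {f f′ g g′} → f ≋ f′ → g ≋ g′ → (f ⋆ g) n ≈ (f′ ⋆ g′) n
  ⋆-cong zero    f≋f′ g≋g′ = *-cong (f≋f′ 0) (g≋g′ 0)
  ⋆-cong (suc n) f≋f′ g≋g′ = +-cong (*-cong (f≋f′ 0) (g≋g′ (suc n))) (⋆-cong n (λ k → f≋f′ (suc k)) g≋g′)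

  ⋆-zeroˡ : ∀ n {f} g → (∀ k → f k ≈ 0#) → (f ⋆ g) n ≈ 0#
  ⋆-zeroˡ zero    g f≈0 = trans (*-congʳ (f≈0 0)) (zeroˡ _)
  ⋆-zeroˡ (suc n) g f≈0 =
    trans (+-cong (trans (*-congʳ (f≈0 0)) (zeroˡ _)) (⋆-zeroˡ n g (λ k → f≈0 (suc k)))) (+-identityˡ _)

  ⋆-vanishʳ : ∀ n f {g} → (∀ k → k ≤ n → g k ≈ 0#) → (f ⋆ g) n ≈ 0#
  ⋆-vanishʳ zero    f g≈0 = trans (*-congˡ (g≈0 0 z≤n)) (zeroʳ _)
  ⋆-vanishʳ (suc n) f g≈0 =
    trans (+-cong (trans (*-congˡ (g≈0 (suc n) ℕ.≤-refl)) (zeroʳ _))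
                  (⋆-vanishʳ n (tail f) (λ k k≤n → g≈0 k (ℕ.m≤n⇒m≤1+n k≤n))))
          (+-identityˡ _)

  ⋆-identityˡ : ∀ n g → (1ₛ ⋆ g) n ≈ g n
  ⋆-identityˡ zero    g = *-identityˡ _
  ⋆-identityˡ (suc n) g = trans (+-cong (*-identityˡ _) (⋆-zeroˡ n g (λ _ → refl))) (+-identityʳ _)

  ⋆-distribʳ : ∀ n f f′ g → ((f +ₛ f′) ⋆ g) n ≈ (f ⋆ g) n + (f′ ⋆ g) n
  ⋆-distribʳ zero    f f′ g = distribʳ _ _ _
  ⋆-distribʳ (suc n) f f′ g =
    trans (+-cong (distribʳ _ _ _) (⋆-distribʳ n (tail f) (tail f′) g))
          (solve 4 (λ a b c d → (a ⊕ b) ⊕ (c ⊕ d) ⊜ (a ⊕ c) ⊕ (b ⊕ d)) refl _ _ _ _)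

  ⋆-scaleˡ : ∀ n a f g → ((λ k → a * f k) ⋆ g) n ≈ a * (f ⋆ g) n
  ⋆-scaleˡ zero    a f g = *-assoc _ _ _
  ⋆-scaleˡ (suc n) a f g = trans (+-cong (*-assoc _ _ _) (⋆-scaleˡ n a (tail f) g)) (sym (distribˡ _ _ _))

  ⋆-unfoldʳ : ∀ n f g → (f ⋆ g) (suc n) ≈ (f ⋆ tail g) n + f (suc n) * g 0
  ⋆-unfoldʳ zero    f g = refl
  ⋆-unfoldʳ (suc n) f g = trans (+-congˡ (⋆-unfoldʳ n (tail f) g)) (sym (+-assoc _ _ _))

  ⋆-comm : ∀ n f g → (f ⋆ g) n ≈ (g ⋆ f) n
  ⋆-comm zero    f g = *-comm _ _
  ⋆-comm (suc n) f g = begin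
    f 0 * g (suc n) + (tail f ⋆ g) n   ≈⟨ +-cong (*-comm _ _) (⋆-comm n (tail f) g) ⟩
    g (suc n) * f 0 + (g ⋆ tail f) n   ≈⟨ +-comm _ _ ⟩
    (g ⋆ tail f) n + g (suc n) * f 0   ≈⟨ ⋆-unfoldʳ n g f ⟨
    (g ⋆ f) (suc n)                    ∎

  ⋆-assoc : ∀ n f g h → ((f ⋆ g) ⋆ h) n ≈ (f ⋆ (g ⋆ h)) n
  ⋆-assoc zero    f g h = *-assoc _ _ _
  ⋆-assoc (suc n) f g h = begin
    (f 0 * g 0) * h (suc n) + (tail (f ⋆ g) ⋆ h) n
      ≈⟨ +-congˡ (⋆-distribʳ n (λ k → f 0 * tail g k) (tail f ⋆ g) h) ⟩
    (f 0 * g 0) * h (suc n) + (((λ k → f 0 * tail g k) ⋆ h) n + ((tail f ⋆ g) ⋆ h) n)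
      ≈⟨ +-congˡ (+-cong (⋆-scaleˡ n (f 0) (tail g) h) (⋆-assoc n (tail f) g h)) ⟩
    (f 0 * g 0) * h (suc n) + (f 0 * (tail g ⋆ h) n + (tail f ⋆ (g ⋆ h)) n)
      ≈⟨ solve 5 (λ a b c d e → (a ⊗ b) ⊗ c ⊕ (a ⊗ d ⊕ e) ⊜ a ⊗ (b ⊗ c ⊕ d) ⊕ e) refl _ _ _ _ _ ⟩
    f 0 * (g 0 * h (suc n) + (tail g ⋆ h) n) + (tail f ⋆ (g ⋆ h)) n
      ∎

  ⋆-distribˡ : ∀ n f g g′ → (f ⋆ (g +ₛ g′)) n ≈ (f ⋆ g) n + (f ⋆ g′) n
  ⋆-distribˡ n f g g′ =
    trans (⋆-comm n f _) (trans (⋆-distribʳ n g g′ f) (+-cong (⋆-comm n g f) (⋆-comm n g′ f)))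

  ⋆-lowest : ∀ i j f g → (∀ k → k < i → f k ≈ 0#) → (∀ k → k < j → g k ≈ 0#) →
             (f ⋆ g) (i ℕ.+ j) ≈ f i * g j
  ⋆-lowest zero zero    f g _ _ = refl
  ⋆-lowest zero (suc j) f g _ g≈0 =
    trans (+-congˡ (⋆-vanishʳ j (tail f) (λ k k≤j → g≈0 k (s≤s k≤j)))) (+-identityʳ _)
  ⋆-lowest (suc i) j f g f≈0 g≈0 =
    trans (+-cong (trans (*-congʳ (f≈0 0 (s≤s z≤n))) (zeroˡ _))
                  (⋆-lowest i j (tail f) g (λ k k<i → f≈0 (suc k) (s≤s k<i)) g≈0))
          (+-identityˡ _)

  seqRawRing : RawRing c ℓ
  seqRawRing = record
    { _≈_ = _≋_ ; _+_ = _+ₛ_ ; _*_ = _⋆_ ; -_ = -ₛ_ ; 0# = 0ₛ ; 1# = 1ₛ }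

  seqIsCommutativeRing : IsCommutativeRing _≋_ _+ₛ_ _⋆_ -ₛ_ 0ₛ 1ₛ
  seqIsCommutativeRing = record
    { isRing = record
      { +-isAbelianGroup = record
        { isGroup = record
          { isMonoid = record
            { isSemigroup = record
              { isMagma = record
                { isEquivalence = record
                  { refl = λ _ → refl ; sym = λ e n → sym (e n) ; trans = λ e e′ n → trans (e n) (e′ n) }
                ; ∙-cong = λ e e′ n → +-cong (e n) (e′ n) }
              ; assoc = λ f g h n → +-assoc _ _ _ }
            ; identity = (λ f n → +-identityˡ _) , (λ f n → +-identityʳ _) }
          ; inverse = (λ f n → -‿inverseˡ _) , (λ f n → -‿inverseʳ _)
          ; ⁻¹-cong = λ e n → -‿cong (e n) }
        ; comm = λ f g n → +-comm _ _ }
      ; *-cong = λ e e′ n → ⋆-cong n e e′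
      ; *-assoc = λ f g h n → ⋆-assoc n f g h
      ; *-identity = (λ f n → ⋆-identityˡ n f) , (λ f n → trans (⋆-comm n f 1ₛ) (⋆-identityˡ n f))
      ; distrib = (λ f g h n → ⋆-distribˡ n f g h) , (λ f g h n → ⋆-distribʳ n g h f) }
    ; *-comm = λ f g n → ⋆-comm n f g }

module Polynomials where

  module ℚSeq = CauchyProduct ℚ.+-*-commutativeRing
  open ℚSeq using (_⋆_)

  coeffP-addP : ∀ p r n → coeffP (addP p r) n ≡ coeffP p n ℚ.+ coeffP r n
  coeffP-addP []      r       n       = ≡.sym (ℚ.+-identityˡ _)
  coeffP-addP (a ∷ p) []      n       = ≡.sym (ℚ.+-identityʳ _)
  coeffP-addP (a ∷ p) (b ∷ r) zero    = ≡.refl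
  coeffP-addP (a ∷ p) (b ∷ r) (suc n) = coeffP-addP p r n

  coeffP-scaleP : ∀ c p n → coeffP (scaleP c p) n ≡ c ℚ.* coeffP p n
  coeffP-scaleP c []      n       = ≡.sym (ℚ.*-zeroʳ c)
  coeffP-scaleP c (a ∷ p) zero    = ≡.refl
  coeffP-scaleP c (a ∷ p) (suc n) = coeffP-scaleP c p n

  coeffP-mulP : ∀ p r n → coeffP (mulP p r) n ≡ (coeffP p ⋆ coeffP r) n
  coeffP-mulP []      r n       = ≡.sym (ℚSeq.⋆-zeroˡ n (coeffP r) (λ _ → ≡.refl))
  coeffP-mulP (a ∷ p) r zero    =
    ≡.trans (coeffP-addP (scaleP a r) (0ℚ ∷ mulP p r) 0) (≡.trans (ℚ.+-identityʳ _) (coeffP-scaleP a r 0))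
  coeffP-mulP (a ∷ p) r (suc n) =
    ≡.trans (coeffP-addP (scaleP a r) (0ℚ ∷ mulP p r) (suc n))
            (cong₂ ℚ._+_ (coeffP-scaleP a r (suc n)) (coeffP-mulP p r n))

  negP : Poly → Poly
  negP = scaleP (ℚ.- 1ℚ)

  coeffP-negP : ∀ p n → coeffP (negP p) n ≡ ℚ.- coeffP p n
  coeffP-negP p n = ≡.trans (coeffP-scaleP (ℚ.- 1ℚ) p n)
    (≡.trans (≡.sym (ℚ.neg-distribˡ-* 1ℚ (coeffP p n))) (cong ℚ.-_ (ℚ.*-identityˡ (coeffP p n))))

  coeffP-1 : ∀ n → coeffP (1ℚ ∷ []) n ≡ ℚSeq.1ₛ n
  coeffP-1 zero    = ≡.refl
  coeffP-1 (suc n) = ≡.refl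

  -- _≈P_ is a function type, from which Agda cannot recover the compared polynomials;
  -- the record wrapper makes them inferable.  The same is done for _≈R_ and _≈S_ below.
  infix 4 _≋P_
  record _≋P_ (p r : Poly) : Set where
    constructor ≈P⇒≋P
    field ≋P⇒≈P : p ≈P r
  open _≋P_ public

  polyRawRing : RawRing _ _
  polyRawRing = record
    { _≈_ = _≋P_ ; _+_ = addP ; _*_ = mulP ; -_ = negP ; 0# = [] ; 1# = 1ℚ ∷ [] }

  coeffP-isRingMonomorphism : IsRingMonomorphism polyRawRing ℚSeq.seqRawRing coeffP
  coeffP-isRingMonomorphism = record
    { isRingHomomorphism = record
      { isSemiringHomomorphism = record
        { isNearSemiringHomomorphism = record
          { +-isMonoidHomomorphism = record
            { isMagmaHomomorphism = record
              { isRelHomomorphism = record { cong = ≋P⇒≈P }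
              ; homo = coeffP-addP }
            ; ε-homo = λ _ → ≡.refl }
          ; *-homo = coeffP-mulP }
        ; 1#-homo = coeffP-1 }
      ; -‿homo = coeffP-negP }
    ; injective = ≈P⇒≋P }

  polyCommutativeRing : CommutativeRing _ _
  polyCommutativeRing = record
    { isCommutativeRing =
        RingMonomorphism.isCommutativeRing coeffP-isRingMonomorphism ℚSeq.seqIsCommutativeRing }

  NonZeroP : Poly → Set
  NonZeroP p = Σ ℕ λ n → coeffP p n ≢ 0ℚ

  Any≢0⇒NonZeroP : ∀ {p} → Any (_≢ 0ℚ) p → NonZeroP p
  Any≢0⇒NonZeroP (here c≢0)  = 0 , c≢0
  Any≢0⇒NonZeroP (there any) = let n , c≢0 = Any≢0⇒NonZeroP any in suc n , c≢0

  ¬Any≢0⇒coeffP≡0 : ∀ p → ¬ Any (_≢ 0ℚ) p → ∀ k → coeffP p k ≡ 0ℚ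
  ¬Any≢0⇒coeffP≡0 []      _   k       = ≡.refl
  ¬Any≢0⇒coeffP≡0 (c ∷ p) p≡0 zero    with c ℚ.≟ 0ℚ
  ... | yes c≡0 = c≡0
  ... | no  c≢0 = ⊥-elim (p≡0 (here c≢0))
  ¬Any≢0⇒coeffP≡0 (c ∷ p) p≡0 (suc k) = ¬Any≢0⇒coeffP≡0 p (λ any → p≡0 (there any)) k

  lowestNonZero : (f : ℕ → ℚ) (n : ℕ) → f n ≢ 0ℚ →
                  Σ ℕ λ i → (∀ k → k < i → f k ≡ 0ℚ) × f i ≢ 0ℚ
  lowestNonZero f n fn≢0 with f 0 ℚ.≟ 0ℚ
  ... | no f0≢0 = 0 , (λ _ ()) , f0≢0
  lowestNonZero f zero    fn≢0 | yes f0≡0 = ⊥-elim (fn≢0 f0≡0)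
  lowestNonZero f (suc n) fn≢0 | yes f0≡0 =
    let i , below , fi≢0 = lowestNonZero (λ k → f (suc k)) n fn≢0
    in suc i , (λ { zero _ → f0≡0 ; (suc k) (s≤s k<i) → below k k<i }) , fi≢0

  -- The product of the lowest nonzero coefficients is a coefficient of the product.
  mulP-nonZero : ∀ p r → NonZeroP p → NonZeroP r → NonZeroP (mulP p r)
  mulP-nonZero p r (n , pn≢0) (m , rm≢0) =
    let i , p-below , pi≢0 = lowestNonZero (coeffP p) n pn≢0
        j , r-below , rj≢0 = lowestNonZero (coeffP r) m rm≢0
    in i ℕ.+ j , λ eq → x#0y#0→xy#0 pi≢0 rj≢0
         (≡.trans (≡.sym (ℚSeq.⋆-lowest i j (coeffP p) (coeffP r) p-below r-below))
                  (≡.trans (≡.sym (coeffP-mulP p r (i ℕ.+ j))) eq))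
    where open import Algebra.Apartness.Properties.HeytingCommutativeRing ℚ.heytingCommutativeRing
            using (x#0y#0→xy#0)

  prodNZ-nonZero : ∀ ds → NonZeroP (prodNZ ds)
  prodNZ-nonZero []       = 0 , ℚ.1≢0
  prodNZ-nonZero (d ∷ ds) = mulP-nonZero (proj₁ d) (prodNZ ds) (Any≢0⇒NonZeroP (proj₂ d)) (prodNZ-nonZero ds)

  module PolyRing = CommutativeRing polyCommutativeRing
  module PolySolver = IntegerCoefficientSolver polyCommutativeRing

  mulP-zero⇒zero : ∀ p t → NonZeroP p → mulP p t ≋P [] → t ≋P []
  mulP-zero⇒zero p t p≢0 pt≈0 = ≈P⇒≋P t≈0
    where
    t≈0 : t ≈P []
    t≈0 n with coeffP t n ℚ.≟ 0ℚ
    ... | yes tn≡0 = tn≡0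
    ... | no  tn≢0 = let k , ptk≢0 = mulP-nonZero p t p≢0 (n , tn≢0) in ⊥-elim (ptk≢0 (≋P⇒≈P pt≈0 k))

  mulP-cancelˡ : ∀ p r s → NonZeroP p → mulP p r ≋P mulP p s → r ≋P s
  mulP-cancelˡ p r s p≢0 pr≈ps = begin
    r                    ≈⟨ solve 2 (λ r s → r ⊜ (r ⊕ ⊝ s) ⊕ s) refl r s ⟩
    (r - s) + s          ≈⟨ +-congʳ (mulP-zero⇒zero p (r - s) p≢0 p[r-s]≈0) ⟩
    [] + s               ≈⟨ +-identityˡ s ⟩
    s                    ∎
    where
    open PolyRing
    open PolySolver using (solve; _⊜_; _⊕_; _⊗_; ⊝_; 0ₑ)
    open import Relation.Binary.Reasoning.Setoid setoid
    p[r-s]≈0 : p * (r - s) ≋P []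
    p[r-s]≈0 = begin
      p * (r - s)          ≈⟨ distribˡ p r (- s) ⟩
      p * r + p * (- s)    ≈⟨ +-congʳ pr≈ps ⟩
      p * s + p * (- s)    ≈⟨ solve 2 (λ p s → p ⊗ s ⊕ p ⊗ (⊝ s) ⊜ 0ₑ) refl p s ⟩
      []                   ∎

open Polynomials

module RationalFunctions where

  open PolyRing using (_+_; _*_; -_; +-cong; *-cong; -‿cong; *-assoc; *-identityˡ)
    renaming (refl to ≋P-refl; sym to ≋P-sym; trans to ≋P-trans)
  open PolySolver using (solve; _⊜_; _⊕_; _⊗_; ⊝_; 0ₑ; 1ₑ)
  open import Relation.Binary.Reasoning.Setoid PolyRing.setoid

  prodNZ-++ : ∀ ds es → prodNZ (ds ++ es) ≋P prodNZ ds * prodNZ es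
  prodNZ-++ []       es = ≋P-sym (*-identityˡ (prodNZ es))
  prodNZ-++ (d ∷ ds) es = begin
    proj₁ d * prodNZ (ds ++ es)        ≈⟨ *-cong (≋P-refl {proj₁ d}) (prodNZ-++ ds es) ⟩
    proj₁ d * (prodNZ ds * prodNZ es)  ≈⟨ *-assoc (proj₁ d) _ _ ⟨
    (proj₁ d * prodNZ ds) * prodNZ es  ∎

  num : Rat → Poly
  num = Rat.num

  infix 4 _≐_/_
  _≐_/_ : Rat → Poly → Poly → Set
  r ≐ n / D = (num r ≋P n) × (den r ≋P D)

  ≐-self : ∀ r → r ≐ num r / den r
  ≐-self r = ≋P-refl , ≋P-refl

  ≐-+R : ∀ r s {n D m E} → r ≐ n / D → s ≐ m / E → r +R s ≐ n * E + m * D / D * E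
  ≐-+R r s (n≈ , D≈) (m≈ , E≈) =
    +-cong (*-cong n≈ E≈) (*-cong m≈ D≈) , ≋P-trans (prodNZ-++ (Rat.dens r) (Rat.dens s)) (*-cong D≈ E≈)

  ≐-*R : ∀ r s {n D m E} → r ≐ n / D → s ≐ m / E → r *R s ≐ n * m / D * E
  ≐-*R r s (n≈ , D≈) (m≈ , E≈) = *-cong n≈ m≈ , ≋P-trans (prodNZ-++ (Rat.dens r) (Rat.dens s)) (*-cong D≈ E≈)

  ≐--R : ∀ r {n D} → r ≐ n / D → -R r ≐ - n / D
  ≐--R r (n≈ , D≈) = -‿cong n≈ , D≈

  infix 4 _≋R_
  record _≋R_ (r s : Rat) : Set where
    constructor ≈R⇒≋R
    field ≋R⇒≈R : r ≈R s
  open _≋R_ public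

  cross-multiply : ∀ {r s} → r ≋R s → num r * den s ≋P num s * den r
  cross-multiply r≈s = ≈P⇒≋P (≋R⇒≈R r≈s)

  ≋R-from-≐ : ∀ r s {n D m E} → r ≐ n / D → s ≐ m / E → n * E ≋P m * D → r ≋R s
  ≋R-from-≐ r s (n≈ , D≈) (m≈ , E≈) nE≈mD =
    ≈R⇒≋R (≋P⇒≈P (≋P-trans (*-cong n≈ E≈) (≋P-trans nE≈mD (≋P-sym (*-cong m≈ D≈)))))

  ≋R-refl : ∀ {r} → r ≋R r
  ≋R-refl = ≈R⇒≋R (λ _ → ≡.refl)

  ≋R-sym : ∀ {r s} → r ≋R s → s ≋R r
  ≋R-sym r≈s = ≈R⇒≋R (λ n → ≡.sym (≋R⇒≈R r≈s n))

  -- Cancel the (nonzero) denominator of the middle fraction.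
  ≋R-trans : ∀ {r s t} → r ≋R s → s ≋R t → r ≋R t
  ≋R-trans {r} {s} {t} r≈s s≈t =
    ≈R⇒≋R (≋P⇒≈P (mulP-cancelˡ D₂ (n₁ * D₃) (n₃ * D₁) (prodNZ-nonZero (Rat.dens s)) D₂n₁D₃≈D₂n₃D₁))
    where
    n₁ = num r ; n₂ = num s ; n₃ = num t
    D₁ = den r ; D₂ = den s ; D₃ = den t
    D₂n₁D₃≈D₂n₃D₁ : D₂ * (n₁ * D₃) ≋P D₂ * (n₃ * D₁)
    D₂n₁D₃≈D₂n₃D₁ = begin
      D₂ * (n₁ * D₃)   ≈⟨ solve 3 (λ a b c → a ⊗ (b ⊗ c) ⊜ (b ⊗ a) ⊗ c) ≋P-refl D₂ n₁ D₃ ⟩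
      (n₁ * D₂) * D₃   ≈⟨ *-cong (cross-multiply r≈s) (≋P-refl {D₃}) ⟩
      (n₂ * D₁) * D₃   ≈⟨ solve 3 (λ a b c → (a ⊗ b) ⊗ c ⊜ (a ⊗ c) ⊗ b) ≋P-refl n₂ D₁ D₃ ⟩
      (n₂ * D₃) * D₁   ≈⟨ *-cong (cross-multiply s≈t) (≋P-refl {D₁}) ⟩
      (n₃ * D₂) * D₁   ≈⟨ solve 3 (λ a b c → (a ⊗ b) ⊗ c ⊜ b ⊗ (a ⊗ c)) ≋P-refl n₃ D₂ D₁ ⟩
      D₂ * (n₃ * D₁)   ∎

  +R-cong : ∀ {r r′ s s′} → r ≋R r′ → s ≋R s′ → r +R s ≋R r′ +R s′
  +R-cong {r} {r′} {s} {s′} r≈r′ s≈s′ =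
    ≋R-from-≐ (r +R s) (r′ +R s′) (≐-+R r s (≐-self r) (≐-self s)) (≐-+R r′ s′ (≐-self r′) (≐-self s′)) (begin
      (n₁ * E₁ + m₁ * D₁) * (D₂ * E₂)
        ≈⟨ solve 6 (λ n₁ D₁ D₂ m₁ E₁ E₂ → (n₁ ⊗ E₁ ⊕ m₁ ⊗ D₁) ⊗ (D₂ ⊗ E₂)
                                           ⊜ (n₁ ⊗ D₂) ⊗ (E₁ ⊗ E₂) ⊕ (m₁ ⊗ E₂) ⊗ (D₁ ⊗ D₂))
                   ≋P-refl n₁ D₁ D₂ m₁ E₁ E₂ ⟩
      (n₁ * D₂) * (E₁ * E₂) + (m₁ * E₂) * (D₁ * D₂)
        ≈⟨ +-cong (*-cong (cross-multiply r≈r′) ≋P-refl) (*-cong (cross-multiply s≈s′) ≋P-refl) ⟩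
      (n₂ * D₁) * (E₁ * E₂) + (m₂ * E₁) * (D₁ * D₂)
        ≈⟨ solve 6 (λ n₂ D₁ D₂ m₂ E₁ E₂ → (n₂ ⊗ D₁) ⊗ (E₁ ⊗ E₂) ⊕ (m₂ ⊗ E₁) ⊗ (D₁ ⊗ D₂)
                                           ⊜ (n₂ ⊗ E₂ ⊕ m₂ ⊗ D₂) ⊗ (D₁ ⊗ E₁))
                   ≋P-refl n₂ D₁ D₂ m₂ E₁ E₂ ⟩
      (n₂ * E₂ + m₂ * D₂) * (D₁ * E₁)
        ∎)
    where
    n₁ = num r ; m₁ = num s ; n₂ = num r′ ; m₂ = num s′
    D₁ = den r ; E₁ = den s ; D₂ = den r′ ; E₂ = den s′

  *R-cong : ∀ {r r′ s s′} → r ≋R r′ → s ≋R s′ → r *R s ≋R r′ *R s′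
  *R-cong {r} {r′} {s} {s′} r≈r′ s≈s′ =
    ≋R-from-≐ (r *R s) (r′ *R s′) (≐-*R r s (≐-self r) (≐-self s)) (≐-*R r′ s′ (≐-self r′) (≐-self s′)) (begin
      (n₁ * m₁) * (D₂ * E₂)   ≈⟨ solve 4 (λ a b c d → (a ⊗ b) ⊗ (c ⊗ d) ⊜ (a ⊗ c) ⊗ (b ⊗ d)) ≋P-refl n₁ m₁ D₂ E₂ ⟩
      (n₁ * D₂) * (m₁ * E₂)   ≈⟨ *-cong (cross-multiply r≈r′) (cross-multiply s≈s′) ⟩
      (n₂ * D₁) * (m₂ * E₁)   ≈⟨ solve 4 (λ a b c d → (a ⊗ c) ⊗ (b ⊗ d) ⊜ (a ⊗ b) ⊗ (c ⊗ d)) ≋P-refl n₂ m₂ D₁ E₁ ⟩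
      (n₂ * m₂) * (D₁ * E₁)   ∎)
    where
    n₁ = num r ; m₁ = num s ; n₂ = num r′ ; m₂ = num s′
    D₁ = den r ; E₁ = den s ; D₂ = den r′ ; E₂ = den s′

  -R-cong : ∀ {r r′} → r ≋R r′ → -R r ≋R -R r′
  -R-cong {r} {r′} r≈r′ = ≋R-from-≐ (-R r) (-R r′) (≐--R r (≐-self r)) (≐--R r′ (≐-self r′)) (begin
      (- num r) * den r′     ≈⟨ solve 2 (λ a b → (⊝ a) ⊗ b ⊜ ⊝ (a ⊗ b)) ≋P-refl (num r) (den r′) ⟩
      - (num r * den r′)     ≈⟨ -‿cong (cross-multiply r≈r′) ⟩
      - (num r′ * den r)     ≈⟨ solve 2 (λ a b → ⊝ (a ⊗ b) ⊜ (⊝ a) ⊗ b) ≋P-refl (num r′) (den r) ⟩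
      (- num r′) * den r     ∎)

  +R-congˡ : ∀ r {s s′} → s ≋R s′ → r +R s ≋R r +R s′
  +R-congˡ r = +R-cong (≋R-refl {r})

  module _ (r s t : Rat) where
    private
      n₁ = num r ; D₁ = den r ; n₂ = num s ; D₂ = den s ; n₃ = num t ; D₃ = den t
      r≐ = ≐-self r ; s≐ = ≐-self s ; t≐ = ≐-self t

    +R-assoc : (r +R s) +R t ≋R r +R (s +R t)
    +R-assoc = ≋R-from-≐ _ _ (≐-+R (r +R s) t (≐-+R r s r≐ s≐) t≐) (≐-+R r (s +R t) r≐ (≐-+R s t s≐ t≐))
      (solve 6 (λ n₁ D₁ n₂ D₂ n₃ D₃ → ((n₁ ⊗ D₂ ⊕ n₂ ⊗ D₁) ⊗ D₃ ⊕ n₃ ⊗ (D₁ ⊗ D₂)) ⊗ (D₁ ⊗ (D₂ ⊗ D₃))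
                                      ⊜ (n₁ ⊗ (D₂ ⊗ D₃) ⊕ (n₂ ⊗ D₃ ⊕ n₃ ⊗ D₂) ⊗ D₁) ⊗ ((D₁ ⊗ D₂) ⊗ D₃))
             ≋P-refl n₁ D₁ n₂ D₂ n₃ D₃)

    *R-assoc : (r *R s) *R t ≋R r *R (s *R t)
    *R-assoc = ≋R-from-≐ _ _ (≐-*R (r *R s) t (≐-*R r s r≐ s≐) t≐) (≐-*R r (s *R t) r≐ (≐-*R s t s≐ t≐))
      (solve 6 (λ n₁ D₁ n₂ D₂ n₃ D₃ → ((n₁ ⊗ n₂) ⊗ n₃) ⊗ (D₁ ⊗ (D₂ ⊗ D₃)) ⊜ (n₁ ⊗ (n₂ ⊗ n₃)) ⊗ ((D₁ ⊗ D₂) ⊗ D₃))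
             ≋P-refl n₁ D₁ n₂ D₂ n₃ D₃)

    *R-distribʳ : (s +R t) *R r ≋R (s *R r) +R (t *R r)
    *R-distribʳ = ≋R-from-≐ _ _ (≐-*R (s +R t) r (≐-+R s t s≐ t≐) r≐)
                                (≐-+R (s *R r) (t *R r) (≐-*R s r s≐ r≐) (≐-*R t r t≐ r≐))
      (solve 6 (λ n₁ D₁ n₂ D₂ n₃ D₃ → ((n₂ ⊗ D₃ ⊕ n₃ ⊗ D₂) ⊗ n₁) ⊗ ((D₂ ⊗ D₁) ⊗ (D₃ ⊗ D₁))
                                      ⊜ ((n₂ ⊗ n₁) ⊗ (D₃ ⊗ D₁) ⊕ (n₃ ⊗ n₁) ⊗ (D₂ ⊗ D₁)) ⊗ ((D₂ ⊗ D₃) ⊗ D₁))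
             ≋P-refl n₁ D₁ n₂ D₂ n₃ D₃)

  module _ (r s : Rat) where
    private
      n₁ = num r ; D₁ = den r ; n₂ = num s ; D₂ = den s
      r≐ = ≐-self r ; s≐ = ≐-self s

    +R-comm : r +R s ≋R s +R r
    +R-comm = ≋R-from-≐ _ _ (≐-+R r s r≐ s≐) (≐-+R s r s≐ r≐)
      (solve 4 (λ n₁ D₁ n₂ D₂ → (n₁ ⊗ D₂ ⊕ n₂ ⊗ D₁) ⊗ (D₂ ⊗ D₁) ⊜ (n₂ ⊗ D₁ ⊕ n₁ ⊗ D₂) ⊗ (D₁ ⊗ D₂))
             ≋P-refl n₁ D₁ n₂ D₂)

    *R-comm : r *R s ≋R s *R r
    *R-comm = ≋R-from-≐ _ _ (≐-*R r s r≐ s≐) (≐-*R s r s≐ r≐)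
      (solve 4 (λ n₁ D₁ n₂ D₂ → (n₁ ⊗ n₂) ⊗ (D₂ ⊗ D₁) ⊜ (n₂ ⊗ n₁) ⊗ (D₁ ⊗ D₂)) ≋P-refl n₁ D₁ n₂ D₂)

  module _ (r : Rat) where
    private
      n = num r ; D = den r ; r≐ = ≐-self r

    +R-identityˡ : 0R +R r ≋R r
    +R-identityˡ = ≋R-from-≐ _ _ (≐-+R 0R r (≐-self 0R) r≐) r≐
      (solve 2 (λ n D → (0ₑ ⊗ D ⊕ n ⊗ 1ₑ) ⊗ D ⊜ n ⊗ (1ₑ ⊗ D)) ≋P-refl n D)

    *R-identityˡ : 1R *R r ≋R r
    *R-identityˡ = ≋R-from-≐ _ _ (≐-*R 1R r (≐-self 1R) r≐) r≐
      (solve 2 (λ n D → (1ₑ ⊗ n) ⊗ D ⊜ n ⊗ (1ₑ ⊗ D)) ≋P-refl n D)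

    -R-inverseˡ : (-R r) +R r ≋R 0R
    -R-inverseˡ = ≋R-from-≐ _ _ (≐-+R (-R r) r (≐--R r r≐) r≐) (≐-self 0R)
      (solve 2 (λ n D → ((⊝ n) ⊗ D ⊕ n ⊗ D) ⊗ 1ₑ ⊜ 0ₑ ⊗ (D ⊗ D)) ≋P-refl n D)

  ratIsCommutativeRing : IsCommutativeRing _≋R_ _+R_ _*R_ -R_ 0R 1R
  ratIsCommutativeRing = record
    { isRing = record
      { +-isAbelianGroup = record
        { isGroup = record
          { isMonoid = record
            { isSemigroup = record
              { isMagma = record
                { isEquivalence = record { refl = ≋R-refl ; sym = ≋R-sym ; trans = ≋R-trans }
                ; ∙-cong = +R-cong }
              ; assoc = +R-assoc }
            ; identity = +R-identityˡ , λ r → ≋R-trans (+R-comm r 0R) (+R-identityˡ r) }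
          ; inverse = -R-inverseˡ , λ r → ≋R-trans (+R-comm r (-R r)) (-R-inverseˡ r)
          ; ⁻¹-cong = -R-cong }
        ; comm = +R-comm }
      ; *-cong = *R-cong
      ; *-assoc = *R-assoc
      ; *-identity = *R-identityˡ , λ r → ≋R-trans (*R-comm r 1R) (*R-identityˡ r)
      ; distrib = (λ r s t → ≋R-trans (*R-comm r (s +R t))
                    (≋R-trans (*R-distribʳ r s t) (+R-cong (*R-comm s r) (*R-comm t r))))
                , *R-distribʳ }
    ; *-comm = *R-comm }

  ratCommutativeRing : CommutativeRing _ _
  ratCommutativeRing = record { isCommutativeRing = ratIsCommutativeRing }

open RationalFunctions

module PowerSeries where

  module RatRing = CommutativeRing ratCommutativeRing
  module RatSolver = IntegerCoefficientSolver ratCommutativeRing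
  module RatSeq = CauchyProduct ratCommutativeRing
  open RatSeq using (_⋆_; tail)

  sumTo≡Σ≤ : ∀ n F → sumTo n F ≡ RatSeq.Σ≤ n F
  sumTo≡Σ≤ zero    F = ≡.refl
  sumTo≡Σ≤ (suc n) F = ≡.cong (_+R F (suc n)) (sumTo≡Σ≤ n F)

  *S≋⋆ : ∀ f g n → (f *S g) n ≋R (f ⋆ g) n
  *S≋⋆ f g n = ≡.subst (_≋R (f ⋆ g) n) (≡.sym (sumTo≡Σ≤ n _)) (RatSeq.Σ≤-⋆ n f g)

  infix 4 _≋S_
  record _≋S_ (f g : PS) : Set where
    constructor ≈S⇒≋S
    field ≋S⇒≈S : f ≈S g
  open _≋S_ public

  ≋S⇒≋R : ∀ {f g} → f ≋S g → ∀ n → f n ≋R g n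
  ≋S⇒≋R f≈g n = ≈R⇒≋R (≋S⇒≈S f≈g n)

  psRawRing : RawRing _ _
  psRawRing = record { _≈_ = _≋S_ ; _+_ = _+S_ ; _*_ = _*S_ ; -_ = -S_ ; 0# = 0S ; 1# = 1S }

  0S≋0ₛ : ∀ n → 0S n ≋R RatSeq.0ₛ n
  0S≋0ₛ zero    = ≋R-refl
  0S≋0ₛ (suc n) = ≋R-refl

  1S≋1ₛ : ∀ n → 1S n ≋R RatSeq.1ₛ n
  1S≋1ₛ zero    = ≋R-refl
  1S≋1ₛ (suc n) = ≋R-refl

  id-isRingMonomorphism : IsRingMonomorphism psRawRing RatSeq.seqRawRing (λ f → f)
  id-isRingMonomorphism = record
    { isRingHomomorphism = record
      { isSemiringHomomorphism = record
        { isNearSemiringHomomorphism = record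
          { +-isMonoidHomomorphism = record
            { isMagmaHomomorphism = record
              { isRelHomomorphism = record { cong = ≋S⇒≋R }
              ; homo = λ f g n → ≋R-refl }
            ; ε-homo = 0S≋0ₛ }
          ; *-homo = *S≋⋆ }
        ; 1#-homo = 1S≋1ₛ }
      ; -‿homo = λ f n → ≋R-refl }
    ; injective = λ f≈g → ≈S⇒≋S (λ n → ≋R⇒≈R (f≈g n)) }

  psCommutativeRing : CommutativeRing _ _
  psCommutativeRing = record
    { isCommutativeRing =
        RingMonomorphism.isCommutativeRing id-isRingMonomorphism RatSeq.seqIsCommutativeRing }

  1R≉0R : ¬ (1R ≋R 0R)
  1R≉0R 1≈0 = ℚ.1≢0 (≋R⇒≈R 1≈0 0)

  invR-inverseʳ : ∀ r → ¬ (r ≋R 0R) → r *R invR r ≋R 1R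
  invR-inverseʳ (frac n ds) r≉0 with any? (λ c → ¬? (c ℚ.≟ 0ℚ)) n
  ... | yes n≢0 = ≋R-from-≐ _ 1R (≐-*R r r⁻¹ (≐-self r) (≐-self r⁻¹)) (≐-self 1R)
        (solve 2 (λ n D → (n ⊗ D) ⊗ 1ₑ ⊜ 1ₑ ⊗ (D ⊗ (n ⊗ 1ₑ))) PolyRing.refl n (prodNZ ds))
    where
    open PolySolver using (solve; _⊜_; _⊗_; 1ₑ)
    r = frac n ds
    r⁻¹ = frac (prodNZ ds) ((n , n≢0) ∷ [])
  ... | no  n≡0 = ⊥-elim (r≉0 (≈R⇒≋R num≈0))
    where
    num≈0 : mulP n (1ℚ ∷ []) ≈P mulP [] (prodNZ ds)
    num≈0 k = ≡.trans (coeffP-mulP n (1ℚ ∷ []) k) (ℚSeq.⋆-zeroˡ k _ (¬Any≢0⇒coeffP≡0 n n≡0))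

  invList≡ : ∀ f n → invList f n ≡ map (invS f) (downFrom (suc n))
  invList≡ f zero    = ≡.refl
  invList≡ f (suc n) = ≡.cong (invS f (suc n) ∷_) (invList≡ f n)

  sumR-zipWith≋⋆ : ∀ n F G → sumR (zipWith _*R_ (applyUpTo F (suc n)) (map G (downFrom (suc n)))) ≋R (F ⋆ G) n
  sumR-zipWith≋⋆ zero    F G = RatRing.+-identityʳ (F 0 *R G 0)
  sumR-zipWith≋⋆ (suc n) F G = +R-congˡ (F 0 *R G (suc n)) (sumR-zipWith≋⋆ n (λ k → F (suc k)) G)

  -- The sum Z that invList f (suc n) multiplies by −f₀⁻¹ is (tail f ⋆ invS f) n,
  -- so the new coefficient cancels it.
  invS-inverseʳ : ∀ f → f 0 *R invR (f 0) ≋R 1R → f *S invS f ≋S 1S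
  invS-inverseʳ f f₀f₀⁻¹≈1 = ≈S⇒≋S (λ n → ≋R⇒≈R (≋R-trans (*S≋⋆ f g n) (f⋆g≈1 n)))
    where
    open RatRing using (_+_; _*_; -_; refl)
    open RatSolver using (solve; _⊜_; _⊕_; _⊗_; ⊝_; 0ₑ; 1ₑ)
    open import Relation.Binary.Reasoning.Setoid RatRing.setoid
    g = invS f
    f⋆g≈1 : ∀ n → (f ⋆ g) n ≋R 1S n
    f⋆g≈1 zero    = f₀f₀⁻¹≈1
    f⋆g≈1 (suc n) = begin
      f₀ * - (f₀⁻¹ * Z) + (tail f ⋆ g) n
        ≈⟨ +R-congˡ (f₀ * - (f₀⁻¹ * Z)) Z≈ ⟨
      f₀ * - (f₀⁻¹ * Z) + Z
        ≈⟨ solve 3 (λ a i z → a ⊗ (⊝ (i ⊗ z)) ⊕ z ⊜ ⊝ ((a ⊗ i) ⊗ z) ⊕ z) refl f₀ f₀⁻¹ Z ⟩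
      - ((f₀ * f₀⁻¹) * Z) + Z
        ≈⟨ +R-cong (-R-cong (*R-cong f₀f₀⁻¹≈1 (≋R-refl {Z}))) (≋R-refl {Z}) ⟩
      - (1R * Z) + Z
        ≈⟨ solve 1 (λ z → ⊝ (1ₑ ⊗ z) ⊕ z ⊜ 0ₑ) refl Z ⟩
      0R
        ∎
      where
      f₀ = f 0
      f₀⁻¹ = invR (f 0)
      Z = sumR (zipWith _*R_ (map (λ i → f (suc i)) (upTo (suc n))) (invList f n))
      Z≈ : Z ≋R (tail f ⋆ g) n
      Z≈ = ≡.subst (_≋R (tail f ⋆ g) n)
             (≡.sym (≡.cong₂ (λ xs ys → sumR (zipWith _*R_ xs ys)) (map-upTo (tail f) (suc n)) (invList≡ f n)))
             (sumR-zipWith≋⋆ n (tail f) g)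

open PowerSeries

module Matrices where

  module PSRing = CommutativeRing psCommutativeRing
  module PSSolver = IntegerCoefficientSolver psCommutativeRing
  open PSRing using (_+_; _-_; _*_; -_; +-cong; *-cong; -‿cong)
    renaming (refl to ≋S-refl; sym to ≋S-sym; trans to ≋S-trans)
  open PSSolver using (solve; _⊜_; _⊕_; _⊗_; ⊝_; 0ₑ; 1ₑ)
  open import Relation.Binary.Reasoning.Setoid PSRing.setoid

  V2 : Set
  V2 = PS × PS

  infix 4 _≋V_
  _≋V_ : V2 → V2 → Set
  (u , v) ≋V (u′ , v′) = (u ≋S u′) × (v ≋S v′)

  ≋V-refl : ∀ {w} → w ≋V w
  ≋V-refl = ≋S-refl , ≋S-refl

  ≋V-sym : ∀ {w w′} → w ≋V w′ → w′ ≋V w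
  ≋V-sym (e₁ , e₂) = ≋S-sym e₁ , ≋S-sym e₂

  ≋V-trans : ∀ {w w′ w″} → w ≋V w′ → w′ ≋V w″ → w ≋V w″
  ≋V-trans (e₁ , e₂) (f₁ , f₂) = ≋S-trans e₁ f₁ , ≋S-trans e₂ f₂

  V2-setoid : Setoid _ _
  V2-setoid = record
    { Carrier = V2 ; _≈_ = _≋V_
    ; isEquivalence = record { refl = ≋V-refl ; sym = ≋V-sym ; trans = ≋V-trans } }

  infixl 6 _-V_
  _-V_ : V2 → V2 → V2
  (u , v) -V (u′ , v′) = (u -S u′) , (v -S v′)

  infix 6 -V_
  -V_ : V2 → V2
  -V (u , v) = (-S u) , (-S v)

  infixr 7 _·_
  _·_ : M2 → V2 → V2
  mat a b c d · (u , v) = ((a *S u) +S (b *S v)) , ((c *S u) +S (d *S v))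

  ·-congˡ : ∀ M {w w′} → w ≋V w′ → M · w ≋V M · w′
  ·-congˡ (mat a b c d) (e₁ , e₂) =
    +-cong (*-cong (≋S-refl {a}) e₁) (*-cong (≋S-refl {b}) e₂) ,
    +-cong (*-cong (≋S-refl {c}) e₁) (*-cong (≋S-refl {d}) e₂)

  -V-cong : ∀ {w₁ w₁′ w₂ w₂′} → w₁ ≋V w₁′ → w₂ ≋V w₂′ → w₁ -V w₂ ≋V w₁′ -V w₂′
  -V-cong (e₁ , e₂) (f₁ , f₂) = +-cong e₁ (-‿cong f₁) , +-cong e₂ (-‿cong f₂)

  -V-congˡ : ∀ w {w₂ w₂′} → w₂ ≋V w₂′ → w -V w₂ ≋V w -V w₂′
  -V-congˡ w = -V-cong (≋V-refl {w})

  I2-M-· : ∀ X w → (I2 -M X) · w ≋V w -V X · w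
  I2-M-· (mat a b c d) (u , v) =
    solve 6 (λ a b c d u v → (1ₑ ⊕ ⊝ a) ⊗ u ⊕ (0ₑ ⊕ ⊝ b) ⊗ v ⊜ u ⊕ ⊝ (a ⊗ u ⊕ b ⊗ v)) ≋S-refl a b c d u v ,
    solve 6 (λ a b c d u v → (0ₑ ⊕ ⊝ c) ⊗ u ⊕ (1ₑ ⊕ ⊝ d) ⊗ v ⊜ v ⊕ ⊝ (c ⊗ u ⊕ d ⊗ v)) ≋S-refl a b c d u v

  *M-· : ∀ X Y w → (X *M Y) · w ≋V X · Y · w
  *M-· (mat a b c d) (mat e f g h) (u , v) =
    solve 10 (λ a b c d e f g h u v → (a ⊗ e ⊕ b ⊗ g) ⊗ u ⊕ (a ⊗ f ⊕ b ⊗ h) ⊗ v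
                                       ⊜ a ⊗ (e ⊗ u ⊕ f ⊗ v) ⊕ b ⊗ (g ⊗ u ⊕ h ⊗ v)) ≋S-refl a b c d e f g h u v ,
    solve 10 (λ a b c d e f g h u v → (c ⊗ e ⊕ d ⊗ g) ⊗ u ⊕ (c ⊗ f ⊕ d ⊗ h) ⊗ v
                                       ⊜ c ⊗ (e ⊗ u ⊕ f ⊗ v) ⊕ d ⊗ (g ⊗ u ⊕ h ⊗ v)) ≋S-refl a b c d e f g h u v

  ·-distrib-V : ∀ M w w′ → M · (w -V w′) ≋V M · w -V M · w′
  ·-distrib-V (mat a b c d) (u , v) (u′ , v′) =
    solve 8 (λ a b c d u v u′ v′ → a ⊗ (u ⊕ ⊝ u′) ⊕ b ⊗ (v ⊕ ⊝ v′) ⊜ (a ⊗ u ⊕ b ⊗ v) ⊕ ⊝ (a ⊗ u′ ⊕ b ⊗ v′))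
      ≋S-refl a b c d u v u′ v′ ,
    solve 8 (λ a b c d u v u′ v′ → c ⊗ (u ⊕ ⊝ u′) ⊕ d ⊗ (v ⊕ ⊝ v′) ⊜ (c ⊗ u ⊕ d ⊗ v) ⊕ ⊝ (c ⊗ u′ ⊕ d ⊗ v′))
      ≋S-refl a b c d u v u′ v′

  invM-·-cancel : ∀ M w → det M *S invS (det M) ≋S 1S → invM M · M · w ≋V w
  invM-·-cancel M@(mat a b c d) (u , v) Δi≈1 = (begin
      (i * d) * (a * u + b * v) + (i * - b) * (c * u + d * v)
        ≈⟨ solve 7 (λ a b c d i u v → (i ⊗ d) ⊗ (a ⊗ u ⊕ b ⊗ v) ⊕ (i ⊗ (⊝ b)) ⊗ (c ⊗ u ⊕ d ⊗ v)
                                      ⊜ ((a ⊗ d ⊕ ⊝ (b ⊗ c)) ⊗ i) ⊗ u) ≋S-refl a b c d i u v ⟩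
      (Δ * i) * u     ≈⟨ *-cong Δi≈1 (≋S-refl {u}) ⟩
      1S * u          ≈⟨ PSRing.*-identityˡ u ⟩
      u               ∎) , (begin
      (i * - c) * (a * u + b * v) + (i * a) * (c * u + d * v)
        ≈⟨ solve 7 (λ a b c d i u v → (i ⊗ (⊝ c)) ⊗ (a ⊗ u ⊕ b ⊗ v) ⊕ (i ⊗ a) ⊗ (c ⊗ u ⊕ d ⊗ v)
                                      ⊜ ((a ⊗ d ⊕ ⊝ (b ⊗ c)) ⊗ i) ⊗ v) ≋S-refl a b c d i u v ⟩
      (Δ * i) * v     ≈⟨ *-cong Δi≈1 (≋S-refl {v}) ⟩
      1S * v          ≈⟨ PSRing.*-identityˡ v ⟩
      v               ∎)
    where
    Δ = det M
    i = invS Δ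

  I2-· : ∀ w → I2 · w ≋V w
  I2-· (u , v) =
    solve 2 (λ u v → 1ₑ ⊗ u ⊕ 0ₑ ⊗ v ⊜ u) ≋S-refl u v ,
    solve 2 (λ u v → 0ₑ ⊗ u ⊕ 1ₑ ⊗ v ⊜ v) ≋S-refl u v

  ·-ones : ∀ M → M · (1S , 1S) ≋V (row1·11 M , row2·11 M)
  ·-ones (mat a b c d) =
    +-cong (PSRing.*-identityʳ a) (PSRing.*-identityʳ b) , +-cong (PSRing.*-identityʳ c) (PSRing.*-identityʳ d)

  infixl 6 _+V_
  _+V_ : V2 → V2 → V2
  (u , v) +V (u′ , v′) = (u +S u′) , (v +S v′)

  step⇒diff : ∀ p q u → q ≋S p + u → p - q ≋S - u
  step⇒diff p q u q≈p+u = begin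
    p - q         ≈⟨ +-cong (≋S-refl {p}) (-‿cong q≈p+u) ⟩
    p - (p + u)   ≈⟨ solve 2 (λ p u → p ⊕ ⊝ (p ⊕ u) ⊜ ⊝ u) ≋S-refl p u ⟩
    - u           ∎

  step⇒shifted-diff : ∀ p q u z → q ≋S p + u → p - (q - z) ≋S z - u
  step⇒shifted-diff p q u z q≈p+u = begin
    p - (q - z)         ≈⟨ +-cong (≋S-refl {p}) (-‿cong (+-cong q≈p+u (≋S-refl { - z}))) ⟩
    p - ((p + u) - z)   ≈⟨ solve 3 (λ p u z → p ⊕ ⊝ ((p ⊕ u) ⊕ ⊝ z) ⊜ z ⊕ ⊝ u) ≋S-refl p u z ⟩
    z - u               ∎

  step⇒diffV : ∀ p q u → q ≋V p +V u → p -V q ≋V -V u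
  step⇒diffV (p₁ , p₂) (q₁ , q₂) (u₁ , u₂) (e₁ , e₂) = step⇒diff p₁ q₁ u₁ e₁ , step⇒diff p₂ q₂ u₂ e₂

  step⇒shifted-diffV : ∀ p q u z → q ≋V p +V u → p -V (q -V z) ≋V z -V u
  step⇒shifted-diffV (p₁ , p₂) (q₁ , q₂) (u₁ , u₂) (z₁ , z₂) (e₁ , e₂) =
    step⇒shifted-diff p₁ q₁ u₁ z₁ e₁ , step⇒shifted-diff p₂ q₂ u₂ z₂ e₂

open Matrices

module Divisibility where

  open PSSolver using (solve; _⊜_; _⊕_; _⊗_; ⊝_)

  infix 4 x^_∣_ x^_∣V_
  x^_∣_ : ℕ → PS → Set
  x^ m ∣ f = ∀ n → n < m → f n ≋R 0R

  x^_∣V_ : ℕ → V2 → Set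
  x^ m ∣V (u , v) = (x^ m ∣ u) × (x^ m ∣ v)

  x^0∣ : ∀ f → x^ 0 ∣ f
  x^0∣ f n ()

  x^∣-cong : ∀ {m f g} → f ≋S g → x^ m ∣ f → x^ m ∣ g
  x^∣-cong f≈g m∣f n n<m = ≋R-trans (≋R-sym (≋S⇒≋R f≈g n)) (m∣f n n<m)

  x^∣-≤ : ∀ {m m′ f} → m ≤ m′ → x^ m′ ∣ f → x^ m ∣ f
  x^∣-≤ m≤m′ m′∣f n n<m = m′∣f n (ℕ.<-≤-trans n<m m≤m′)

  x^∣-+ : ∀ {m f g} → x^ m ∣ f → x^ m ∣ g → x^ m ∣ f +S g
  x^∣-+ m∣f m∣g n n<m = ≋R-trans (+R-cong (m∣f n n<m) (m∣g n n<m)) (RatRing.+-identityˡ 0R)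

  x^∣-neg : ∀ {m f} → x^ m ∣ f → x^ m ∣ -S f
  x^∣-neg m∣f n n<m = ≋R-trans (-R-cong (m∣f n n<m)) -0#≈0#
    where open import Algebra.Properties.Ring RatRing.ring using (-0#≈0#)

  x^∣-*ˡ : ∀ {m} g {f} → x^ m ∣ f → x^ m ∣ g *S f
  x^∣-*ˡ g {f} m∣f n n<m =
    ≋R-trans (*S≋⋆ g f n) (RatSeq.⋆-vanishʳ n g (λ k k≤n → m∣f k (ℕ.≤-<-trans k≤n n<m)))

  x^∣-x*ˡ : ∀ {m} u {f} → u 0 ≋R 0R → x^ m ∣ f → x^ suc m ∣ u *S f
  x^∣-x*ˡ u {f} u₀≈0 m∣f zero _ = ≋R-trans (*R-cong u₀≈0 (≋R-refl {f 0})) (RatRing.zeroˡ (f 0))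
  x^∣-x*ˡ u {f} u₀≈0 m∣f (suc n) (s≤s n<m) =
    ≋R-trans (*S≋⋆ u f (suc n))
      (≋R-trans (+R-cong (≋R-trans (*R-cong u₀≈0 (≋R-refl {f (suc n)})) (RatRing.zeroˡ (f (suc n))))
                         (RatSeq.⋆-vanishʳ n (RatSeq.tail u) (λ k k≤n → m∣f k (ℕ.≤-<-trans k≤n n<m))))
                (RatRing.+-identityˡ 0R))

  x^∣-diff-trans : ∀ {m} f g h → x^ m ∣ f -S g → x^ m ∣ g -S h → x^ m ∣ f -S h
  x^∣-diff-trans f g h m∣f-g m∣g-h =
    x^∣-cong (solve 3 (λ f g h → (f ⊕ ⊝ g) ⊕ (g ⊕ ⊝ h) ⊜ f ⊕ ⊝ h) PSRing.refl f g h) (x^∣-+ m∣f-g m∣g-h)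

  x^∣-diff⇒≋S : ∀ {f g} → (∀ n → x^ suc n ∣ f -S g) → f ≋S g
  x^∣-diff⇒≋S {f} {g} ∣f-g = ≈S⇒≋S (λ n → ≋R⇒≈R (x∙y⁻¹≈ε⇒x≈y (f n) (g n) (∣f-g n n ℕ.≤-refl)))
    where open import Algebra.Properties.Group RatRing.+-group using (x∙y⁻¹≈ε⇒x≈y)

  x^∣V-cong : ∀ {m w w′} → w ≋V w′ → x^ m ∣V w → x^ m ∣V w′
  x^∣V-cong (e₁ , e₂) (m∣u , m∣v) = x^∣-cong e₁ m∣u , x^∣-cong e₂ m∣v

  x^∣V-≤ : ∀ {m m′ w} → m ≤ m′ → x^ m′ ∣V w → x^ m ∣V w
  x^∣V-≤ m≤m′ (m∣u , m∣v) = x^∣-≤ m≤m′ m∣u , x^∣-≤ m≤m′ m∣v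

  x^∣V-neg : ∀ {m w} → x^ m ∣V w → x^ m ∣V -V w
  x^∣V-neg (m∣u , m∣v) = x^∣-neg m∣u , x^∣-neg m∣v

  x^∣V-diff-trans : ∀ {m} w₁ w₂ w₃ → x^ m ∣V w₁ -V w₂ → x^ m ∣V w₂ -V w₃ → x^ m ∣V w₁ -V w₃
  x^∣V-diff-trans (u₁ , v₁) (u₂ , v₂) (u₃ , v₃) (m∣u₁₂ , m∣v₁₂) (m∣u₂₃ , m∣v₂₃) =
    x^∣-diff-trans u₁ u₂ u₃ m∣u₁₂ m∣u₂₃ , x^∣-diff-trans v₁ v₂ v₃ m∣v₁₂ m∣v₂₃

  x^∣V-· : ∀ {m} M {w} → x^ m ∣V w → x^ m ∣V M · w
  x^∣V-· (mat a b c d) (m∣u , m∣v) =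
    x^∣-+ (x^∣-*ˡ a m∣u) (x^∣-*ˡ b m∣v) , x^∣-+ (x^∣-*ˡ c m∣u) (x^∣-*ˡ d m∣v)

  x^∣V-U· : ∀ {m} h {w} → x^ m ∣V w → x^ suc m ∣V U h · w
  x^∣V-U· h (m∣u , m∣v) =
    x^∣-+ (x^∣-x*ˡ 0S ≋R-refl m∣u) (x^∣-x*ˡ (aS h) ≋R-refl m∣v) ,
    x^∣-+ (x^∣-x*ˡ (bS h) ≋R-refl m∣u) (x^∣-x*ˡ 0S ≋R-refl m∣v)

  AgreeAt : ℕ → M2 → M2 → Set
  AgreeAt n M M′ = (m11 M n ≈R m11 M′ n) × (m12 M n ≈R m12 M′ n)
                 × (m21 M n ≈R m21 M′ n) × (m22 M n ≈R m22 M′ n)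

  agree⇒x^∣ : ∀ {m} f g → (∀ k → k < m → f k ≈R g k) → x^ m ∣ f -S g
  agree⇒x^∣ f g agree k k<m = x≈y⇒x∙y⁻¹≈ε {f k} {g k} (≈R⇒≋R (agree k k<m))
    where open import Algebra.Properties.Group RatRing.+-group using (x≈y⇒x∙y⁻¹≈ε)

  agree⇒x^∣V : ∀ n E S w → (∀ k → k ≤ n → AgreeAt k E S) → x^ suc n ∣V E · w -V S · w
  agree⇒x^∣V n E@(mat e₁₁ e₁₂ e₂₁ e₂₂) S@(mat s₁₁ s₁₂ s₂₁ s₂₂) (u , v) agree =
    x^∣-cong (regroup e₁₁ e₁₂ s₁₁ s₁₂) (x^∣-+ (x^∣-*ˡ u close₁₁) (x^∣-*ˡ v close₁₂)) ,
    x^∣-cong (regroup e₂₁ e₂₂ s₂₁ s₂₂) (x^∣-+ (x^∣-*ˡ u close₂₁) (x^∣-*ˡ v close₂₂))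
    where
    at : ∀ k → k < suc n → AgreeAt k E S
    at k (s≤s k≤n) = agree k k≤n
    close₁₁ : x^ suc n ∣ e₁₁ -S s₁₁
    close₁₁ = agree⇒x^∣ e₁₁ s₁₁ (λ k k<n → proj₁ (at k k<n))
    close₁₂ : x^ suc n ∣ e₁₂ -S s₁₂
    close₁₂ = agree⇒x^∣ e₁₂ s₁₂ (λ k k<n → proj₁ (proj₂ (at k k<n)))
    close₂₁ : x^ suc n ∣ e₂₁ -S s₂₁
    close₂₁ = agree⇒x^∣ e₂₁ s₂₁ (λ k k<n → proj₁ (proj₂ (proj₂ (at k k<n))))
    close₂₂ : x^ suc n ∣ e₂₂ -S s₂₂
    close₂₂ = agree⇒x^∣ e₂₂ s₂₂ (λ k k<n → proj₂ (proj₂ (proj₂ (at k k<n))))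
    regroup : ∀ e₁ e₂ s₁ s₂ → (u *S (e₁ -S s₁)) +S (v *S (e₂ -S s₂))
                              ≋S ((e₁ *S u) +S (e₂ *S v)) -S ((s₁ *S u) +S (s₂ *S v))
    regroup e₁ e₂ s₁ s₂ = solve 6 (λ e₁ e₂ s₁ s₂ u v → u ⊗ (e₁ ⊕ ⊝ s₁) ⊕ v ⊗ (e₂ ⊕ ⊝ s₂)
                                                      ⊜ (e₁ ⊗ u ⊕ e₂ ⊗ v) ⊕ ⊝ (s₁ ⊗ u ⊕ s₂ ⊗ v))
                                   PSRing.refl e₁ e₂ s₁ s₂ u v

  x^∣V-diff⇒≋V : ∀ w w′ → (∀ n → x^ suc n ∣V w -V w′) → w ≋V w′
  x^∣V-diff⇒≋V (u , v) (u′ , v′) ∣w-w′ =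
    x^∣-diff⇒≋S (λ n → proj₁ (∣w-w′ n)) , x^∣-diff⇒≋S (λ n → proj₂ (∣w-w′ n))

open Divisibility

module ConstantTerms where

  open RatSolver using (solve; _⊜_; _⊕_; _⊗_; ⊝_; 0ₑ; 1ₑ)

  ConstantTermI : M2 → Set
  ConstantTermI M = (m11 M 0 ≋R 1R) × (m12 M 0 ≋R 0R) × (m21 M 0 ≋R 0R) × (m22 M 0 ≋R 1R)

  det-constantTerm : ∀ M → ConstantTermI M → det M 0 ≋R 1R
  det-constantTerm M (e₁₁ , e₁₂ , e₂₁ , e₂₂) =
    ≋R-trans (+R-cong (*R-cong e₁₁ e₂₂) (-R-cong (*R-cong e₁₂ e₂₁)))
             (solve 0 (1ₑ ⊗ 1ₑ ⊕ ⊝ (0ₑ ⊗ 0ₑ) ⊜ 1ₑ) RatRing.refl)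

  det-invertible : ∀ M → ConstantTermI M → det M *S invS (det M) ≋S 1S
  det-invertible M M₀≈I = invS-inverseʳ (det M) (invR-inverseʳ (det M 0) Δ₀≉0)
    where
    Δ₀≉0 : ¬ (det M 0 ≋R 0R)
    Δ₀≉0 Δ₀≈0 = 1R≉0R (≋R-trans (≋R-sym (det-constantTerm M M₀≈I)) Δ₀≈0)

  Sk-constantTerm : ∀ k h → ConstantTermI (Sk k h)
  Sk-constantTerm zero    h = ≋R-refl , ≋R-refl , ≋R-refl , ≋R-refl
  Sk-constantTerm (suc k) h =
    solve 2 (λ p q → 1ₑ ⊕ ⊝ (0ₑ ⊗ p ⊕ 0ₑ ⊗ q) ⊜ 1ₑ) refl (m11 Y 0) (m21 Y 0) ,
    solve 2 (λ p q → 0ₑ ⊕ ⊝ (0ₑ ⊗ p ⊕ 0ₑ ⊗ q) ⊜ 0ₑ) refl (m12 Y 0) (m22 Y 0) ,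
    solve 2 (λ p q → 0ₑ ⊕ ⊝ (0ₑ ⊗ p ⊕ 0ₑ ⊗ q) ⊜ 0ₑ) refl (m11 Y 0) (m21 Y 0) ,
    solve 2 (λ p q → 1ₑ ⊕ ⊝ (0ₑ ⊗ p ⊕ 0ₑ ⊗ q) ⊜ 1ₑ) refl (m12 Y 0) (m22 Y 0)
    where
    refl : ∀ {r} → r ≋R r
    refl = ≋R-refl
    Y = invM (Sk k (suc h))

  IsS0⇒constantTerm : ∀ S → IsS0 S → ConstantTermI S
  IsS0⇒constantTerm S isS =
    let N₀ , agree = isS 0
        e₁₁ , e₁₂ , e₂₁ , e₂₂ = agree N₀ ℕ.≤-refl
        c₁₁ , c₁₂ , c₂₁ , c₂₂ = Sk-constantTerm (suc N₀) 0
    in transfer c₁₁ e₁₁ , transfer c₁₂ e₁₂ , transfer c₂₁ e₂₁ , transfer c₂₂ e₂₂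
    where
    transfer : ∀ {r s t} → r ≋R t → r ≈R s → s ≋R t
    transfer r≈t r≈s = ≋R-trans (≋R-sym (≈R⇒≋R r≈s)) r≈t

open ConstantTerms

eventually-∀≤ : {P : ℕ → ℕ → Set} → (∀ k → ∃[ N₀ ] ∀ N → N₀ ≤ N → P k N) →
                ∀ n → ∃[ N₀ ] ∀ N → N₀ ≤ N → ∀ k → k ≤ n → P k N
eventually-∀≤ {P} ev zero = let N₀ , P0 = ev 0 in N₀ , λ { N N₀≤N .0 z≤n → P0 N N₀≤N }
eventually-∀≤ {P} ev (suc n) = N₁ ⊔ N₂ , all
  where
  N₁ = proj₁ (eventually-∀≤ ev n)
  N₂ = proj₁ (ev (suc n))
  all : ∀ N → N₁ ⊔ N₂ ≤ N → ∀ k → k ≤ suc n → P k N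
  all N N₀≤N k k≤1+n with ℕ.m≤n⇒m<n∨m≡n k≤1+n
  ... | inj₁ (s≤s k≤n) = proj₂ (eventually-∀≤ ev n) N (ℕ.≤-trans (ℕ.m≤m⊔n N₁ N₂) N₀≤N) k k≤n
  ... | inj₂ ≡.refl    = proj₂ (ev (suc n)) N (ℕ.≤-trans (ℕ.m≤n⊔m N₁ N₂) N₀≤N)

module ContinuedFraction (A B : ℕ → PS)
  (A₀-rec : A 0 ≈S (1S +S (aS 0 *S B 1)))
  (B₀-rec : B 0 ≈S (1S +S (bS 0 *S A 1)))
  (A-rec : ∀ h → A (suc h) ≈S (A h +S (aS (suc h) *S B (suc (suc h)))))
  (B-rec : ∀ h → B (suc h) ≈S (B h +S (bS (suc h) *S A (suc (suc h)))))
  where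

  open PSRing using () renaming (refl to ≋S-refl; trans to ≋S-trans)
  open PSSolver using (solve; _⊜_; _⊕_; _⊗_; 0ₑ)

  -- With W 0 = (1, 1), the recurrences for A 0 and B 0 are the case h = 0 of W-rec.
  W : ℕ → V2
  W zero    = 1S , 1S
  W (suc h) = A h , B h

  W-rec : ∀ h → W (suc h) ≋V W h +V U h · W (suc (suc h))
  W-rec h = ≋S-trans (A-step h) (pad (proj₁ (W h)) (aS h) (proj₁ W₂) (proj₂ W₂)) ,
            ≋S-trans (B-step h) (pad′ (proj₂ (W h)) (bS h) (proj₁ W₂) (proj₂ W₂))
    where
    W₂ = W (suc (suc h))
    A-step : ∀ h → proj₁ (W (suc h)) ≋S proj₁ (W h) +S (aS h *S proj₂ (W (suc (suc h))))
    A-step zero    = ≈S⇒≋S A₀-rec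
    A-step (suc h) = ≈S⇒≋S (A-rec h)
    B-step : ∀ h → proj₂ (W (suc h)) ≋S proj₂ (W h) +S (bS h *S proj₁ (W (suc (suc h))))
    B-step zero    = ≈S⇒≋S B₀-rec
    B-step (suc h) = ≈S⇒≋S (B-rec h)
    pad : ∀ p a x y → p +S (a *S y) ≋S p +S ((0S *S x) +S (a *S y))
    pad = solve 4 (λ p a x y → p ⊕ a ⊗ y ⊜ p ⊕ (0ₑ ⊗ x ⊕ a ⊗ y)) ≋S-refl
    pad′ : ∀ p b x y → p +S (b *S x) ≋S p +S ((b *S x) +S (0S *S y))
    pad′ = solve 4 (λ p b x y → p ⊕ b ⊗ x ⊜ p ⊕ (b ⊗ x ⊕ 0ₑ ⊗ y)) ≋S-refl

  Sk-approximates : ∀ k h → x^ suc k ∣V W h -V Sk k h · W (suc h)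
  Sk-approximates zero h =
    x^∣V-cong (≋V-sym W-diff)
      (x^∣V-neg {w = U h · W (suc (suc h))} (x^∣V-U· h {W (suc (suc h))} (x^0∣ _ , x^0∣ _)))
    where
    W-diff : W h -V I2 · W (suc h) ≋V -V U h · W (suc (suc h))
    W-diff = ≋V-trans (-V-congˡ (W h) (I2-· (W (suc h))))
                      (step⇒diffV (W h) (W (suc h)) (U h · W (suc (suc h))) (W-rec h))
  Sk-approximates (suc k) h =
    x^∣V-cong (≋V-sym W-diff) (x^∣V-U· h {Y · Δ} (x^∣V-· Y {Δ} (Sk-approximates k (suc h))))
    where
    open import Relation.Binary.Reasoning.Setoid V2-setoid
    M = Sk k (suc h)
    Y = invM M
    W₁ = W (suc h)
    W₂ = W (suc (suc h))
    Δ = W₁ -V M · W₂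
    W-diff : W h -V Sk (suc k) h · W₁ ≋V U h · Y · (W₁ -V M · W₂)
    W-diff = begin
      W h -V Sk (suc k) h · W₁         ≈⟨ -V-congˡ (W h) (I2-M-· (U h *M Y) W₁) ⟩
      W h -V (W₁ -V (U h *M Y) · W₁)   ≈⟨ -V-congˡ (W h) (-V-congˡ W₁ (*M-· (U h) Y W₁)) ⟩
      W h -V (W₁ -V U h · Y · W₁)      ≈⟨ step⇒shifted-diffV (W h) W₁ (U h · W₂) (U h · Y · W₁) (W-rec h) ⟩
      U h · Y · W₁ -V U h · W₂         ≈⟨ ·-distrib-V (U h) (Y · W₁) W₂ ⟨
      U h · (Y · W₁ -V W₂)             ≈⟨ ·-congˡ (U h) (-V-congˡ (Y · W₁) M⁻¹M≈I) ⟨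
      U h · (Y · W₁ -V Y · M · W₂)     ≈⟨ ·-congˡ (U h) (·-distrib-V Y W₁ (M · W₂)) ⟨
      U h · Y · (W₁ -V M · W₂)         ∎
      where
      M⁻¹M≈I : Y · M · W₂ ≋V W₂
      M⁻¹M≈I = invM-·-cancel M W₂ (det-invertible M (Sk-constantTerm k (suc h)))

  module _ (S₀ : M2) (isS₀ : IsS0 S₀) where

    S₀-approximates : ∀ n → x^ suc n ∣V W 0 -V S₀ · W 1
    S₀-approximates n =
      x^∣V-diff-trans (W 0) (SN0 N · W 1) (S₀ · W 1)
        (x^∣V-≤ (s≤s (ℕ.≤-trans (ℕ.m≤n⊔m N₀ n) (ℕ.n≤1+n N))) (Sk-approximates (suc N) 0))
        (agree⇒x^∣V n (SN0 N) S₀ (W 1) (agree N (ℕ.m≤m⊔n N₀ n)))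
      where
      N₀ = proj₁ (eventually-∀≤ isS₀ n)
      agree = proj₂ (eventually-∀≤ isS₀ n)
      N = N₀ ⊔ n

    W₁≈S₀⁻¹·W₀ : W 1 ≋V invM S₀ · W 0
    W₁≈S₀⁻¹·W₀ = ≋V-sym (x^∣V-diff⇒≋V (invM S₀ · W 0) (W 1) (λ n →
      x^∣V-cong S₀⁻¹·diff (x^∣V-· (invM S₀) {W 0 -V S₀ · W 1} (S₀-approximates n))))
      where
      S₀⁻¹·diff : invM S₀ · (W 0 -V S₀ · W 1) ≋V invM S₀ · W 0 -V W 1
      S₀⁻¹·diff = ≋V-trans (·-distrib-V (invM S₀) (W 0) (S₀ · W 1))
        (-V-congˡ (invM S₀ · W 0) (invM-·-cancel S₀ (W 1) (det-invertible S₀ (IsS0⇒constantTerm S₀ isS₀))))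

theorem3p2 : (S₀ : M2) → IsS0 S₀ → (A B : ℕ → PS)
    → A 0 ≈S (1S +S (aS 0 *S B 1))
    → B 0 ≈S (1S +S (bS 0 *S A 1))
    → (∀ h → A (suc h) ≈S (A h +S (aS (suc h) *S B (suc (suc h)))))
    → (∀ h → B (suc h) ≈S (B h +S (bS (suc h) *S A (suc (suc h)))))
    → (A 0 ≈S row1·11 (invM S₀)) × (B 0 ≈S row2·11 (invM S₀))
theorem3p2 S₀ isS₀ A B A₀-rec B₀-rec A-rec B-rec =
  ≋S⇒≈S (proj₁ W₁≈) , ≋S⇒≈S (proj₂ W₁≈)
  where
  open ContinuedFraction A B A₀-rec B₀-rec A-rec B-rec
  W₁≈ : (A 0 , B 0) ≋V (row1·11 (invM S₀) , row2·11 (invM S₀))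
  W₁≈ = ≋V-trans (W₁≈S₀⁻¹·W₀ S₀ isS₀) (·-ones (invM S₀))
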